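{- For every finite graph $G=(V,E)$, the graph $G'$ defined in the context is chordal bipartite.
   Context: Given $G=(V,E)$, the graph $G'=(V',E')$ is defined as follows: for every $v\in V$ there are two vertices $x_v,y_v\in V'$; for every edge $e=uv\in E$ there are four vertices $p_{e,u},q_{e,u},p_{e,v},q_{e,v}\in V'$; for all $u,v\in V$ (including $u=v$) the edge $x_vy_u$ is in $E'$; for every edge $e=uv\in E$ the edges $p_{e,u}q_{e,u}$, $p_{e,v}q_{e,v}$, $x_up_{e,u}$, $y_vq_{e,u}$, $x_vp_{e,v}$, $y_uq_{e,v}$ are in $E'$. These are all vertices and edges of $G'$. A graph is chordal bipartite if it is bipartite and every cycle of length at least $6$ has a chord. -}

module Defs where

open import Data.Nat using (ℕ; zero; suc; _≤_)
open import Data.Fin using (Fin; toℕ)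
open import Data.Bool using (Bool; true; false; T)
open import Data.Product using (Σ; _×_; _,_; ∃; ∃-syntax)
open import Data.Sum using (_⊎_; inj₁; inj₂)
open import Relation.Binary.PropositionalEquality using (_≡_; _≢_)
open import Relation.Nullary using (¬_)
open import Function.Definitions using (Injective)

record FiniteGraph : Set where
  field
    n     : ℕ
    adj   : Fin n → Fin n → Bool
    sym   : ∀ u v → adj u v ≡ adj v u
    irrefl : ∀ v → adj v v ≡ false

Bipartite : (V : Set) → (V → V → Set) → Set
Bipartite V E = Σ (V → Bool) λ c → ∀ a b → E a b → c a ≢ c b

CycStep : (k : ℕ) → Fin k → Fin k → Set
CycStep k i j = (suc (toℕ i) ≡ toℕ j) ⊎ (suc (toℕ i) ≡ k × toℕ j ≡ 0)

IsCycle : (V : Set) → (V → V → Set) → (k : ℕ) → (Fin k → V) → Set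
IsCycle V E k f = Injective _≡_ _≡_ f × (∀ i j → CycStep k i j → E (f i) (f j))

HasChord : (V : Set) → (V → V → Set) → (k : ℕ) → (Fin k → V) → Set
HasChord V E k f = ∃[ i ] ∃[ j ] (E (f i) (f j) × ¬ CycStep k i j × ¬ CycStep k j i)

ChordalBipartite : (V : Set) → (V → V → Set) → Set
ChordalBipartite V E =
  Bipartite V E × (∀ k → 6 ≤ k → (f : Fin k → V) → IsCycle V E k f → HasChord V E k f)

-- The construction G ↦ G'.
-- For an edge e = uv and its endpoint u, the vertex p_{e,u} is  p u v a  and
-- q_{e,u} is  q u v a, where a : T (adj u v) witnesses the edge (proof-irrelevant).

module _ (G : FiniteGraph) where
  open FiniteGraph G

  data V' : Set where
    x y : Fin n → V'
    p q : (u v : Fin n) → T (adj u v) → V'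

  data E₀ : V' → V' → Set where
    xy : ∀ v u → E₀ (x v) (y u)
    pq : ∀ u v (a : T (adj u v)) → E₀ (p u v a) (q u v a)
    xp : ∀ u v (a : T (adj u v)) → E₀ (x u) (p u v a)
    yq : ∀ u v (a : T (adj u v)) → E₀ (y v) (q u v a)

  E' : V' → V' → Set
  E' a b = E₀ a b ⊎ E₀ b a

module Submission where

-- Colour x- and q-vertices true, y- and p-vertices false; every edge of G'
-- joins the two colours.  For chordality, call the x- and y-vertices the
-- core.  Two facts about G' drive the argument:
--   * the core is complete bipartite: x_v y_u is an edge for all u, v;
--   * a vertex outside the core (a p or q) has degree two, its neighbours
--     being one core vertex and its partner outside the core.  Looking at
-- position 0 of the cycle, and at position 3 when 0 is in the core, one of
-- these two situations always occurs.

open import Defs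
open import Data.Nat using (ℕ; suc; _≤_; s≤s)
open import Data.Fin using (Fin; fromℕ; inject₁) renaming (zero to fz; suc to fs)
open import Data.Fin.Properties using (toℕ-fromℕ; toℕ-inject₁)
open import Data.Bool using (Bool; true; false; not)
open import Data.Bool.Properties using (¬-not; not-¬; not-involutive)
open import Data.Unit using (⊤; tt)
open import Data.Empty using (⊥; ⊥-elim)
open import Data.Product using (_×_; _,_)
open import Data.Sum using (_⊎_; inj₁; inj₂)
open import Relation.Binary.PropositionalEquality using (_≡_; _≢_; refl; sym; cong; trans; subst)
open import Relation.Nullary using (¬_; Dec; yes; no)

oddWalkChangesColour : {a b c d : Bool} → a ≢ b → b ≢ c → c ≢ d → a ≢ d
oddWalkChangesColour {a} {b} {c} {d} a≢b b≢c c≢d =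
  subst (a ≢_) (not-involutive d) (not-¬ a≡notd)
  where
  a≡notd : a ≡ not d
  a≡notd = trans (¬-not a≢b)
             (cong not (trans (¬-not b≢c)
               (trans (cong not (¬-not c≢d)) (not-involutive d))))

module CoreWithPendantPairs
  {V : Set} (E : V → V → Set) (colour : V → Bool) (Core : V → Set)
  (core? : ∀ v → Dec (Core v))
  (properColouring : ∀ a b → E a b → colour a ≢ colour b)
  (coreComplete : ∀ {a b} → Core a → Core b → colour a ≢ colour b → E a b)
  (outerNeighbours : ∀ {b c d} → ¬ Core c → E b c → E c d → b ≢ d →
                     (Core b × ¬ Core d) ⊎ (¬ Core b × Core d))
  where

  coreChordAcross : ∀ {a b c d} → Core a → Core d →
                    E a b → E b c → E c d → E a d
  coreChordAcross {a} {b} {c} {d} core-a core-d ab bc cd =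
    coreComplete core-a core-d
      (oddWalkChangesColour (properColouring a b ab) (properColouring b c bc)
                            (properColouring c d cd))

  -- On a path a–b–c–d–f with c outside the core, c lies on a pendant pair
  -- {c, d} or {b, c}; the core vertices flanking that pair are joined,
  -- giving the edge bf or ad.
  chordAroundPendant : ∀ {a b c d f} → ¬ Core c →
                       E a b → E b c → E c d → E d f →
                       b ≢ d → a ≢ c → c ≢ f → E a d ⊎ E b f
  chordAroundPendant out-c ab bc cd df b≢d a≢c c≢f
    with outerNeighbours out-c bc cd b≢d
  ... | inj₁ (core-b , out-d) with outerNeighbours out-d cd df c≢f
  ...   | inj₁ (core-c , _)     = ⊥-elim (out-c core-c)
  ...   | inj₂ (_ , core-f)     = inj₂ (coreChordAcross core-b core-f bc cd df)
  chordAroundPendant out-c ab bc cd df b≢d a≢c c≢f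
      | inj₂ (out-b , core-d) with outerNeighbours out-b ab bc a≢c
  ...   | inj₁ (core-a , _)     = inj₁ (coreChordAcross core-a core-d ab bc cd)
  ...   | inj₂ (_ , core-c)     = ⊥-elim (out-c core-c)

  cyclesHaveChords : ∀ k → 6 ≤ k → (f : Fin k → V) → IsCycle V E k f → HasChord V E k f
  cyclesHaveChords (suc (suc (suc (suc (suc (suc m))))))
                   (s≤s (s≤s (s≤s (s≤s (s≤s (s≤s _)))))) f (injective , step) = chord
    where
    K : ℕ
    K = suc (suc (suc (suc (suc (suc m)))))

    i0 i1 i2 i3 i4 i5 last last-1 : Fin K
    i0 = fz
    i1 = fs fz
    i2 = fs (fs fz)
    i3 = fs (fs (fs fz))
    i4 = fs (fs (fs (fs fz)))
    i5 = fs (fs (fs (fs (fs fz))))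
    last   = fs (fs (fs (fs (fs (fromℕ m)))))
    last-1 = fs (fs (fs (fs (inject₁ (fromℕ m)))))

    distinct : ∀ {i j} → i ≢ j → f i ≢ f j
    distinct i≢j fi≡fj = i≢j (injective fi≡fj)

    e01 : E (f i0) (f i1)
    e01 = step i0 i1 (inj₁ refl)
    e12 : E (f i1) (f i2)
    e12 = step i1 i2 (inj₁ refl)
    e23 : E (f i2) (f i3)
    e23 = step i2 i3 (inj₁ refl)
    e34 : E (f i3) (f i4)
    e34 = step i3 i4 (inj₁ refl)
    e45 : E (f i4) (f i5)
    e45 = step i4 i5 (inj₁ refl)
    eLast0 : E (f last) (f i0)
    eLast0 = step last i0
      (inj₂ (cong (λ t → suc (suc (suc (suc (suc (suc t)))))) (toℕ-fromℕ m) , refl))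
    eLast : E (f last-1) (f last)
    eLast = step last-1 last
      (inj₁ (cong (λ t → suc (suc (suc (suc (suc t))))) (toℕ-inject₁ (fromℕ m))))

    chord : HasChord V E K f
    chord with core? (f i0)
    chord | no out-0
      with chordAroundPendant out-0 eLast eLast0 e01 e12
             (distinct (λ ())) (distinct (λ ())) (distinct (λ ()))
    ... | inj₁ c = last-1 , i1 , c , (λ { (inj₁ ()) ; (inj₂ (_ , ())) })
                                   , (λ { (inj₁ ()) ; (inj₂ (() , _)) })
    ... | inj₂ c = last , i2 , c , (λ { (inj₁ ()) ; (inj₂ (_ , ())) })
                                 , (λ { (inj₁ ()) ; (inj₂ (() , _)) })
    chord | yes core-0 with core? (f i3)
    ... | yes core-3 = i0 , i3 , coreChordAcross core-0 core-3 e01 e12 e23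
                     , (λ { (inj₁ ()) ; (inj₂ (_ , ())) })
                     , (λ { (inj₁ ()) ; (inj₂ (() , _)) })
    ... | no out-3
      with chordAroundPendant out-3 e12 e23 e34 e45
             (distinct (λ ())) (distinct (λ ())) (distinct (λ ()))
    ...   | inj₁ c = i1 , i4 , c , (λ { (inj₁ ()) ; (inj₂ (_ , ())) })
                                 , (λ { (inj₁ ()) ; (inj₂ (() , _)) })
    ...   | inj₂ c = i2 , i5 , c , (λ { (inj₁ ()) ; (inj₂ (_ , ())) })
                                 , (λ { (inj₁ ()) ; (inj₂ (_ , ())) })

  chordalBipartite : ChordalBipartite V E
  chordalBipartite = (colour , properColouring) , cyclesHaveChords

module ConstructionG' (G : FiniteGraph) where

  colour : V' G → Bool
  colour (x _)     = true
  colour (y _)     = false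
  colour (p _ _ _) = false
  colour (q _ _ _) = true

  colourE₀ : ∀ {a b} → E₀ G a b → colour a ≢ colour b
  colourE₀ (xy _ _)   ()
  colourE₀ (pq _ _ _) ()
  colourE₀ (xp _ _ _) ()
  colourE₀ (yq _ _ _) ()

  properColouring : ∀ a b → E' G a b → colour a ≢ colour b
  properColouring a b (inj₁ e) = colourE₀ e
  properColouring a b (inj₂ e) ab = colourE₀ e (sym ab)

  Core : V' G → Set
  Core (x _) = ⊤
  Core (y _) = ⊤
  Core _     = ⊥

  core? : ∀ v → Dec (Core v)
  core? (x _)     = yes tt
  core? (y _)     = yes tt
  core? (p _ _ _) = no (λ ())
  core? (q _ _ _) = no (λ ())

  coreComplete : ∀ {a b} → Core a → Core b → colour a ≢ colour b → E' G a b
  coreComplete {x v} {y u} _ _ _  = inj₁ (xy v u)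
  coreComplete {y u} {x v} _ _ _  = inj₂ (xy v u)
  coreComplete {x _} {x _} _ _ ne = ⊥-elim (ne refl)
  coreComplete {y _} {y _} _ _ ne = ⊥-elim (ne refl)

  neighboursOfP : ∀ {u v a w} → E' G w (p u v a) → (w ≡ x u) ⊎ (w ≡ q u v a)
  neighboursOfP (inj₁ (xp _ _ _)) = inj₁ refl
  neighboursOfP (inj₂ (pq _ _ _)) = inj₂ refl

  neighboursOfQ : ∀ {u v a w} → E' G w (q u v a) → (w ≡ y v) ⊎ (w ≡ p u v a)
  neighboursOfQ (inj₁ (pq _ _ _)) = inj₂ refl
  neighboursOfQ (inj₁ (yq _ _ _)) = inj₁ refl

  edgeSym : ∀ {a b} → E' G a b → E' G b a
  edgeSym (inj₁ e) = inj₂ e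
  edgeSym (inj₂ e) = inj₁ e

  outerNeighbours : ∀ {b c d} → ¬ Core c → E' G b c → E' G c d → b ≢ d →
                    (Core b × ¬ Core d) ⊎ (¬ Core b × Core d)
  outerNeighbours {c = x _} out _ _ _ = ⊥-elim (out tt)
  outerNeighbours {c = y _} out _ _ _ = ⊥-elim (out tt)
  outerNeighbours {c = p _ _ _} _ bc cd b≢d
    with neighboursOfP bc | neighboursOfP (edgeSym cd)
  ... | inj₁ refl | inj₁ refl = ⊥-elim (b≢d refl)
  ... | inj₁ refl | inj₂ refl = inj₁ (tt , λ ())
  ... | inj₂ refl | inj₁ refl = inj₂ ((λ ()) , tt)
  ... | inj₂ refl | inj₂ refl = ⊥-elim (b≢d refl)
  outerNeighbours {c = q _ _ _} _ bc cd b≢d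
    with neighboursOfQ bc | neighboursOfQ (edgeSym cd)
  ... | inj₁ refl | inj₁ refl = ⊥-elim (b≢d refl)
  ... | inj₁ refl | inj₂ refl = inj₁ (tt , λ ())
  ... | inj₂ refl | inj₁ refl = inj₂ ((λ ()) , tt)
  ... | inj₂ refl | inj₂ refl = ⊥-elim (b≢d refl)

  open CoreWithPendantPairs (E' G) colour Core core? properColouring coreComplete outerNeighbours
    public using (chordalBipartite)

mainTheorem14 : (G : FiniteGraph) → ChordalBipartite (V' G) (E' G)
mainTheorem14 G = ConstructionG'.chordalBipartite G
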